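{- Let $G$ be a labelled sequent that is layered and structurally saturated. Then the relation $\le$ on the layers of $G$ (defined by $L_1\le L_2$ iff there are $x\in L_1$, $y\in L_2$ with $x\le_G y$) is a partial order (reflexive, transitive and antisymmetric).
   Context: A labelled sequent $G$ is $\mathcal{R},\Gamma\Rightarrow\Delta$ with $\mathcal{R}$ a set of relational atoms $xRy$ or $x\le y$ between labels and $\Gamma,\Delta$ multisets of labelled formulas $x{:}A$; write $x\le_G y$, $xR_Gy$ when the corresponding atom is in $\mathcal{R}$, $x{:}C^\bullet$ when $x{:}C\in\Gamma$. $G$ is structurally saturated iff: $x\le_Gy$ and $x{:}C^\bullet$ imply $y{:}C^\bullet$; $xR_Gy$ and $y\le_Gz$ imply $\exists u$ with $x\le_Gu$, $uR_Gz$; $xR_Gy$ and $x\le_Gz$ imply $\exists u$ with $y\le_Gu$, $zR_Gu$; $\le_G$ and $R_G$ are transitive and reflexive on all labels of $G$. A layer of $G$ is an equivalence class of the reflexive transitive closure of $R_G\cup R_G^{ -1}$ on the labels of $G$. $G$ is layered iff for all labels $x,x',y,y'$: (1) if $xR_Gy$ and $x\neq y$ then neither $x\le_Gy$ nor $y\le_Gx$; (2) if $xR_Gy$, $x'R_Gy'$, $x\le_Gx'$ and $x\neq x'$, then not $y'\le_G y$. -}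

module Defs where

open import Data.Nat using (ℕ)
open import Data.Product using (_×_; _,_; ∃; ∃-syntax)
open import Data.Sum using (_⊎_)
open import Data.List using (List)
open import Data.List.Membership.Propositional using (_∈_)
open import Relation.Binary.PropositionalEquality using (_≡_; _≢_)
open import Relation.Binary.Construct.Closure.ReflexiveTransitive using (Star)
open import Relation.Nullary using (¬_)

Label : Set
Label = ℕ

-- Formulas of (intuitionistic) modal logic; only their identity matters here.
data Fm : Set where
  atom : ℕ → Fm
  ⊥f   : Fm
  _∧f_ _∨f_ _⇒f_ : Fm → Fm → Fm
  □f ◇f : Fm → Fm

data RelAtom : Set where
  _R_  : Label → Label → RelAtom
  _≤ₐ_ : Label → Label → RelAtom

LFm : Set
LFm = Label × Fm

-- A labelled sequent  R, Γ ⇒ Δ  (multisets represented as lists).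
record Sequent : Set where
  constructor _,_⇒_
  field
    rel : List RelAtom
    ant : List LFm
    suc : List LFm
open Sequent public

module _ (G : Sequent) where

  _≤G_ : Label → Label → Set
  x ≤G y = (x ≤ₐ y) ∈ rel G

  _RG_ : Label → Label → Set
  x RG y = (x R y) ∈ rel G

  _∶_• : Label → Fm → Set
  x ∶ C • = (x , C) ∈ ant G

  IsLabel : Label → Set
  IsLabel x = (∃[ y ] ((x R y) ∈ rel G ⊎ (y R x) ∈ rel G ⊎ (x ≤ₐ y) ∈ rel G ⊎ (y ≤ₐ x) ∈ rel G))
            ⊎ (∃[ A ] ((x , A) ∈ ant G ⊎ (x , A) ∈ suc G))

  record StructurallySaturated : Set where
    field
      mono    : ∀ {x y C} → x ≤G y → x ∶ C • → y ∶ C •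
      F1      : ∀ {x y z} → x RG y → y ≤G z → ∃[ u ] (x ≤G u × u RG z)
      F2      : ∀ {x y z} → x RG y → x ≤G z → ∃[ u ] (y ≤G u × z RG u)
      ≤-trans : ∀ {x y z} → x ≤G y → y ≤G z → x ≤G z
      R-trans : ∀ {x y z} → x RG y → y RG z → x RG z
      ≤-refl  : ∀ {x} → IsLabel x → x ≤G x
      R-refl  : ∀ {x} → IsLabel x → x RG x

  record Layered : Set where
    field
      lay1 : ∀ {x y} → x RG y → x ≢ y → ¬ (x ≤G y) × ¬ (y ≤G x)
      lay2 : ∀ {x x' y y'} → x RG y → x' RG y' → x ≤G x' → x ≢ x' → ¬ (y' ≤G y)

  RG± : Label → Label → Set
  RG± x y = x RG y ⊎ y RG x

  SameLayer : Label → Label → Set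
  SameLayer = Star RG±

  -- Order on layers, expressed on representatives: the layer of x is ≤ the
  -- layer of y iff some x' in the layer of x and y' in the layer of y have x' ≤_G y'.
  LayerLe : Label → Label → Set
  LayerLe x y = ∃[ x' ] ∃[ y' ] (SameLayer x x' × SameLayer y y' × x' ≤G y')

  record LayerPartialOrder : Set where
    field
      refl    : ∀ {x} → IsLabel x → LayerLe x x
      trans   : ∀ {x y z} → IsLabel x → IsLabel y → IsLabel z →
                LayerLe x y → LayerLe y z → LayerLe x z
      antisym : ∀ {x y} → IsLabel x → IsLabel y →
                LayerLe x y → LayerLe y x → SameLayer x y

module Submission where

-- Conditions F1 and F2 transport a ≤_G-step along a layer: if c and d lie in one layer
-- and c ≤_G e, then d ≤_G e' for some e' in the layer of e.  Hence every layer inequality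
-- can be realised with its lower end at any chosen representative, which gives
-- transitivity, and antisymmetry reduces to convexity of layers: a ≤_G b ≤_G c with a, c
-- in one layer forces b into that layer.  Transporting a ≤_G b to c yields b ≤_G c ≤_G e
-- with b, e in one layer, the same situation one step higher.  Layeredness (2) with
-- reflexive R_G makes ≤_G antisymmetric, so in the finite sequent G these steps cannot
-- climb forever, and the ascent stops at a = b.

open import Defs
open import Data.Nat using (ℕ; _<_; _≤_; s≤s)
open import Data.Nat.Properties using (_≟_; m≤n⇒m≤1+n)
open import Data.Nat.Induction using (<-wellFounded)
open import Data.Product using (_,_; ∃-syntax; _×_)
open import Data.Product.Properties using (≡-dec)
open import Data.Sum using (inj₁; inj₂; swap)
open import Data.List using (_∷_; map; filter; length)
open import Data.List.Membership.Propositional using (_∈_)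
open import Data.List.Membership.Propositional.Properties using (∈-map⁺)
open import Data.List.Relation.Unary.Any using (here; there)
open import Data.List.Relation.Binary.Sublist.Propositional using (⊆-refl)
open import Data.List.Relation.Binary.Sublist.Heterogeneous.Properties using (length-mono-≤; ⊆-filter-Sublist)
open import Relation.Unary using (Pred; Decidable; _⊆_)
open import Relation.Binary.Definitions using (DecidableEquality)
open import Relation.Binary.PropositionalEquality using (_≡_; _≢_; refl)
open import Relation.Binary.Construct.Closure.ReflexiveTransitive using (ε; _◅_; _◅◅_; reverse)
open import Relation.Binary.Construct.On as On using ()
open import Relation.Nullary using (¬_; Dec; yes; no; contradiction)
open import Relation.Nullary.Decidable using (map′)
open import Induction.WellFounded using (Acc; acc)
open import Function using (_on_)
open import Level using (Level)

module _ {a p : Level} {A : Set a} {P Q : Pred A p}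
         (P? : Decidable P) (Q? : Decidable Q) (P⇒Q : P ⊆ Q) where

  length-filter-mono : ∀ xs → length (filter P? xs) ≤ length (filter Q? xs)
  length-filter-mono xs = length-mono-≤ (⊆-filter-Sublist P? Q? (λ { refl → P⇒Q }) (⊆-refl {x = xs}))

  length-filter-< : ∀ {x xs} → x ∈ xs → Q x → ¬ P x →
                    length (filter P? xs) < length (filter Q? xs)
  length-filter-< {x} {_ ∷ xs} (here refl) qx ¬px with P? x | Q? x
  ... | yes px | _      = contradiction px ¬px
  ... | no _   | yes _  = s≤s (length-filter-mono xs)
  ... | no _   | no ¬qx = contradiction qx ¬qx
  length-filter-< {xs = y ∷ xs} (there x∈xs) qx ¬px with P? y | Q? y
  ... | yes _  | yes _  = s≤s (length-filter-< x∈xs qx ¬px)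
  ... | no _   | yes _  = m≤n⇒m≤1+n (length-filter-< x∈xs qx ¬px)
  ... | no _   | no _   = length-filter-< x∈xs qx ¬px
  ... | yes py | no ¬qy = contradiction (P⇒Q py) ¬qy

_≟ₐ_ : DecidableEquality RelAtom
(x R y)  ≟ₐ (u R v)  = map′ (λ { refl → refl }) (λ { refl → refl }) (≡-dec _≟_ _≟_ (x , y) (u , v))
(x ≤ₐ y) ≟ₐ (u ≤ₐ v) = map′ (λ { refl → refl }) (λ { refl → refl }) (≡-dec _≟_ _≟_ (x , y) (u , v))
(_ R _)  ≟ₐ (_ ≤ₐ _) = no λ ()
(_ ≤ₐ _) ≟ₐ (_ R _)  = no λ ()

open import Data.List.Membership.DecPropositional _≟ₐ_ using (_∈?_)

source : RelAtom → Label
source (x R _)  = x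
source (x ≤ₐ _) = x

module _ (G : Sequent) where

  _≤G?_ : ∀ x y → Dec (_≤G_ G x y)
  x ≤G? y = (x ≤ₐ y) ∈? rel G

  -- Finiteness of G enters the proof only through this measure; labels are counted
  -- with multiplicity, as left ends of the atoms of G.
  upCount : Label → ℕ
  upCount x = length (filter (x ≤G?_) (map source (rel G)))

  SameLayer-sym : ∀ {x y} → SameLayer G x y → SameLayer G y x
  SameLayer-sym = reverse swap

  ≤G-IsLabelˡ : ∀ {x y} → _≤G_ G x y → IsLabel G x
  ≤G-IsLabelˡ {y = y} x≤y = inj₁ (y , inj₂ (inj₂ (inj₁ x≤y)))

  ≤G-IsLabelʳ : ∀ {x y} → _≤G_ G x y → IsLabel G y
  ≤G-IsLabelʳ {x} x≤y = inj₁ (x , inj₂ (inj₂ (inj₂ x≤y)))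

  module _ (S : StructurallySaturated G) where
    open StructurallySaturated S

    ≤G-transport : ∀ {c d e} → SameLayer G c d → _≤G_ G c e →
                   ∃[ e' ] (_≤G_ G d e' × SameLayer G e e')
    ≤G-transport {e = e} ε c≤e = e , c≤e , ε
    ≤G-transport (inj₁ cRc₁ ◅ c₁~d) c≤e with F2 cRc₁ c≤e
    ... | u , c₁≤u , eRu with ≤G-transport c₁~d c₁≤u
    ...   | e' , d≤e' , u~e' = e' , d≤e' , inj₁ eRu ◅ u~e'
    ≤G-transport (inj₂ c₁Rc ◅ c₁~d) c≤e with F1 c₁Rc c≤e
    ... | u , c₁≤u , uRe with ≤G-transport c₁~d c₁≤u
    ...   | e' , d≤e' , u~e' = e' , d≤e' , inj₂ uRe ◅ u~e'

    LayerLe-normal : ∀ {x y} → LayerLe G x y → ∃[ y' ] (_≤G_ G x y' × SameLayer G y y')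
    LayerLe-normal (x' , y' , x~x' , y~y' , x'≤y') with ≤G-transport (SameLayer-sym x~x') x'≤y'
    ... | e , x≤e , y'~e = e , x≤e , y~y' ◅◅ y'~e

    module _ (L : Layered G) where
      open Layered L

      ≤G-antisym : ∀ {x y} → _≤G_ G x y → _≤G_ G y x → x ≡ y
      ≤G-antisym {x} {y} x≤y y≤x with x ≟ y
      ... | yes x≡y = x≡y
      ... | no x≢y  = contradiction y≤x
                        (lay2 (R-refl (≤G-IsLabelˡ x≤y)) (R-refl (≤G-IsLabelʳ x≤y)) x≤y x≢y)

      upCount-< : ∀ {x y} → _≤G_ G x y → x ≢ y → upCount y < upCount x
      upCount-< {x} {y} x≤y x≢y =
        length-filter-< (y ≤G?_) (x ≤G?_) (≤-trans x≤y) (∈-map⁺ source x≤x) x≤x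
                        (λ y≤x → x≢y (≤G-antisym x≤y y≤x))
        where x≤x = ≤-refl (≤G-IsLabelˡ x≤y)

      layer-convex-acc : ∀ {a b c} → Acc (_<_ on upCount) a → _≤G_ G a b → _≤G_ G b c →
                         SameLayer G a c → SameLayer G a b
      layer-convex-acc {a} {b} (acc rs) a≤b b≤c a~c with a ≟ b
      ... | yes refl = ε
      ... | no a≢b with ≤G-transport a~c a≤b
      ...   | e , c≤e , b~e =
        a~c ◅◅ SameLayer-sym (layer-convex-acc (rs (upCount-< a≤b a≢b)) b≤c c≤e b~e)

      layer-convex : ∀ {a b c} → _≤G_ G a b → _≤G_ G b c → SameLayer G a c → SameLayer G a b
      layer-convex {a} = layer-convex-acc (On.wellFounded upCount <-wellFounded a)

    LayerLe-refl : ∀ {x} → IsLabel G x → LayerLe G x x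
    LayerLe-refl {x} x∈G = x , x , ε , ε , ≤-refl x∈G

    LayerLe-trans : ∀ {x y z} → LayerLe G x y → LayerLe G y z → LayerLe G x z
    LayerLe-trans {x} x≤y y≤z with LayerLe-normal x≤y | LayerLe-normal y≤z
    ... | y' , x≤y' , y~y' | z' , y≤z' , z~z' with ≤G-transport y~y' y≤z'
    ...   | e , y'≤e , z'~e = x , e , ε , z~z' ◅◅ z'~e , ≤-trans x≤y' y'≤e

    LayerLe-antisym : Layered G → ∀ {x y} → LayerLe G x y → LayerLe G y x → SameLayer G x y
    LayerLe-antisym L x≤y y≤x with LayerLe-normal x≤y | LayerLe-normal y≤x
    ... | y' , x≤y' , y~y' | x' , y≤x' , x~x' with ≤G-transport y~y' y≤x'
    ...   | e , y'≤e , x'~e = layer-convex L x≤y' y'≤e (x~x' ◅◅ x'~e) ◅◅ SameLayer-sym y~y'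

mainTheorem3 : (G : Sequent) → Layered G → StructurallySaturated G → LayerPartialOrder G
mainTheorem3 G L S = record
  { refl    = LayerLe-refl G S
  ; trans   = λ _ _ _ → LayerLe-trans G S
  ; antisym = λ _ _ → LayerLe-antisym G S L
  }
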